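{- Let $\mathcal{G}$ be an additive abelian group of order $n$ and let $A_1,\dots,A_m$ be a partition of $\mathcal{G}$ with $|A_i|=k_i$ for $1\le i\le m$. Then $A_1,\dots,A_m$ is an $(n,m;k_1,\dots,k_m;\lambda_1,\dots,\lambda_m)$-generalized strong external difference family if and only if, for every $1\le i\le m$, $A_i$ is an $(n,k_i,k_i-\lambda_i)$-difference set in $\mathcal{G}$.
   Context: For disjoint subsets $A,B$ of an additive abelian group $\mathcal{G}$, $\mathcal{D}(A,B)$ denotes the multiset $\{x-y : x\in A, y\in B\}$, and for $A\subseteq\mathcal{G}$, $\mathcal{D}(A)$ denotes the multiset $\{x-y: x,y\in A, x\ne y\}$. An $(n,k,\lambda)$-difference set in $\mathcal{G}$ (of order $n$) is a $k$-subset $A$ with $\mathcal{D}(A)=\lambda(\mathcal{G}\setminus\{0\})$ as multisets (every nonzero element occurs exactly $\lambda$ times; a set of size 1 counts as a difference set with $\lambda=0$). An $(n,m;k_1,\dots,k_m;\lambda_1,\dots,\lambda_m)$-generalized strong external difference family (GSEDF) is a collection of $m$ pairwise disjoint subsets $A_1,\dots,A_m$ of $\mathcal{G}$ with $|A_i|=k_i$ such that for every $i$, $\bigcup_{j\ne i}\mathcal{D}(A_i,A_j)=\lambda_i(\mathcal{G}\setminus\{0\})$ as multisets. -}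

module Defs where

open import Level using (0ℓ)
open import Data.Bool using (Bool; true; false; _∧_; not)
open import Data.Nat using (ℕ; zero; suc)
open import Data.Integer as ℤ using (ℤ; +_)
open import Data.Fin using (Fin)
open import Data.Fin.Properties using () renaming (_≟_ to _≟ᶠ_)
open import Data.List using (List; length; filterᵇ; map; allFin; cartesianProduct)
open import Data.Nat.ListAction using (sum)
open import Data.List.Membership.Propositional using (_∈_)
open import Data.List.Relation.Unary.Unique.Propositional using (Unique)
open import Data.Product using (_×_; _,_; ∃; ∃-syntax)
open import Relation.Binary.PropositionalEquality using (_≡_)
open import Relation.Binary.Definitions using (DecidableEquality)
open import Relation.Nullary using (¬_; does)
open import Algebra.Structures using (IsAbelianGroup)

record FiniteAbelianGroup : Set₁ where
  field
    Carrier  : Set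
    _≟_      : DecidableEquality Carrier
    _+_      : Carrier → Carrier → Carrier
    0#       : Carrier
    -_       : Carrier → Carrier
    isAbelianGroup : IsAbelianGroup _≡_ _+_ 0# -_
    elems    : List Carrier
    elems-unique   : Unique elems
    elems-complete : ∀ x → x ∈ elems

  infixl 6 _-_
  _-_ : Carrier → Carrier → Carrier
  x - y = x + (- y)

  order : ℕ
  order = length elems

  Subset : Set
  Subset = Carrier → Bool

  ∣_∣ : Subset → ℕ
  ∣ A ∣ = length (filterᵇ (λ x → A x) elems)

  Disjoint : Subset → Subset → Set
  Disjoint A B = ∀ x → ¬ (A x ≡ true × B x ≡ true)

  pairs : List (Carrier × Carrier)
  pairs = cartesianProduct elems elems

  multD₂ : Subset → Subset → Carrier → ℕ
  multD₂ A B g = length (filterᵇ (λ { (x , y) → A x ∧ B y ∧ does ((x - y) ≟ g) }) pairs)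

  multD : Subset → Carrier → ℕ
  multD A g = length (filterᵇ (λ { (x , y) → A x ∧ A y ∧ not (does (x ≟ y)) ∧ does ((x - y) ≟ g) }) pairs)

  -- A is an (n,k,λ)-difference set (n = order).  The parameter lam is taken
  -- in ℤ so that "(n,k,k-λ)" can be stated literally.
  IsDifferenceSet : Subset → ℕ → ℤ → Set
  IsDifferenceSet A k lam =
    ∣ A ∣ ≡ k ×
    (multD A 0# ≡ 0) ×
    (∀ g → ¬ g ≡ 0# → + multD A g ≡ lam)

  multExt : ∀ {m} → (Fin m → Subset) → Fin m → Carrier → ℕ
  multExt {m} A i g =
    sum (map (λ j → multD₂ (A i) (A j) g) (filterᵇ (λ j → not (does (j ≟ᶠ i))) (allFin m)))

  IsGSEDF : (m : ℕ) → (Fin m → Subset) → (Fin m → ℕ) → (Fin m → ℕ) → Set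
  IsGSEDF m A k lam =
    (∀ i j → ¬ i ≡ j → Disjoint (A i) (A j)) ×
    (∀ i → ∣ A i ∣ ≡ k i) ×
    (∀ i → multExt A i 0# ≡ 0) ×
    (∀ i g → ¬ g ≡ 0# → multExt A i g ≡ lam i)

  IsPartition : (m : ℕ) → (Fin m → Subset) → Set
  IsPartition m A =
    (∀ x → ∃[ i ] (A i x ≡ true × (∀ j → A j x ≡ true → j ≡ i))) ×
    (∀ i → ∃[ x ] A i x ≡ true)

-- For g ≠ 0 and x ∈ Aᵢ, the element x - g lies in exactly one block Aⱼ, and the
-- pair (x, x - g) then contributes to D(Aᵢ) when j = i and to the external
-- differences of Aᵢ otherwise.  Hence the multiplicity of g in D(Aᵢ) plus its
-- multiplicity in ⋃_{j≠i} D(Aᵢ,Aⱼ) is |Aᵢ| = kᵢ, so one is constant λᵢ exactly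
-- when the other is constant kᵢ - λᵢ.  For g = 0 both multiplicities vanish,
-- the second one because the blocks are disjoint.
module Submission where

open import Defs
open import Data.Nat using (ℕ)
open import Data.Integer using (+_; _-_)
open import Data.Fin using (Fin)
open import Data.Product using (_×_)
open import Relation.Binary.PropositionalEquality using (_≡_)
open FiniteAbelianGroup using (Subset; ∣_∣; IsGSEDF; IsDifferenceSet; IsPartition; order)

open import Algebra.Bundles using (AbelianGroup)
import Algebra.Properties.AbelianGroup as AbelianGroupProperties
import Algebra.Properties.Group as GroupProperties
open import Data.Bool using (Bool; true; false; _∧_; not)
open import Data.Bool.Properties using (∧-assoc; ∧-idem; ∧-zeroʳ; ∧-inverseˡ; ¬-not)
open import Data.Fin.Properties using () renaming (_≟_ to _≟ᶠ_)
import Data.Integer as ℤ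
open import Data.Integer.Properties using (+-0-abelianGroup; pos-+)
open import Data.List using (List; []; _∷_; _++_; map; length; filterᵇ; cartesianProduct; allFin)
open import Data.List.Membership.Propositional using (_∈_)
open import Data.List.Membership.Propositional.Properties using (∈-allFin)
open import Data.List.Properties using (map-++; map-∘)
open import Data.List.Relation.Unary.All using (All; []; _∷_)
open import Data.List.Relation.Unary.AllPairs using (_∷_)
open import Data.List.Relation.Unary.Any using (here; there)
open import Data.List.Relation.Unary.Unique.Propositional using (Unique)
open import Data.List.Relation.Unary.Unique.Propositional.Properties using (allFin⁺)
open import Data.Nat as ℕ using (_+_; _*_)
open import Data.Nat.ListAction using (sum)
open import Data.Nat.ListAction.Properties using (sum-++)
open import Data.Nat.Properties using (+-commutativeSemigroup; +-assoc; +-identityʳ; *-identityˡ; *-identityʳ; *-comm; *-distribˡ-+; *-zeroʳ; +-cancelˡ-≡)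
open import Algebra.Properties.CommutativeSemigroup +-commutativeSemigroup
  using () renaming (interchange to +-interchange; x∙yz≈y∙xz to +-x∙yz≈y∙xz)
open import Data.Product using (_,_; proj₁; proj₂)
open import Function using (_∘_)
open import Function.Bundles using (_⇔_; mk⇔; Equivalence)
open import Relation.Binary.Definitions using (DecidableEquality)
open import Relation.Binary.PropositionalEquality using (refl; sym; trans; cong; cong₂; _≢_; _≗_; module ≡-Reasoning)
open import Relation.Nullary using (does; yes; no; contradiction)
open import Relation.Nullary.Decidable using (does-⇔)

𝟙 : Bool → ℕ
𝟙 true  = 1
𝟙 false = 0

𝟙-∧ : ∀ a b → 𝟙 (a ∧ b) ≡ 𝟙 a * 𝟙 b
𝟙-∧ true  b = sym (+-identityʳ (𝟙 b))
𝟙-∧ false b = refl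

𝟙-∧-∧ : ∀ a b c → 𝟙 (a ∧ b ∧ c) ≡ 𝟙 c * 𝟙 (a ∧ b)
𝟙-∧-∧ a b c = begin
  𝟙 (a ∧ b ∧ c)   ≡⟨ cong 𝟙 (sym (∧-assoc a b c)) ⟩
  𝟙 ((a ∧ b) ∧ c) ≡⟨ 𝟙-∧ (a ∧ b) c ⟩
  𝟙 (a ∧ b) * 𝟙 c ≡⟨ *-comm (𝟙 (a ∧ b)) (𝟙 c) ⟩
  𝟙 c * 𝟙 (a ∧ b) ∎
  where open ≡-Reasoning

module _ {a} {X : Set a} where

  ∑ : List X → (X → ℕ) → ℕ
  ∑ xs f = sum (map f xs)

  ∑-cong : {f g : X → ℕ} → f ≗ g → ∀ xs → ∑ xs f ≡ ∑ xs g
  ∑-cong f≗g []       = refl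
  ∑-cong f≗g (x ∷ xs) = cong₂ _+_ (f≗g x) (∑-cong f≗g xs)

  ∑-zero : ∀ xs → ∑ xs (λ _ → 0) ≡ 0
  ∑-zero []       = refl
  ∑-zero (_ ∷ xs) = ∑-zero xs

  ∑-+ : ∀ (f g : X → ℕ) xs → ∑ xs (λ x → f x + g x) ≡ ∑ xs f + ∑ xs g
  ∑-+ f g []       = refl
  ∑-+ f g (x ∷ xs) = trans (cong (λ t → f x + g x + t) (∑-+ f g xs))
                           (+-interchange (f x) (g x) (∑ xs f) (∑ xs g))

  ∑-*ˡ : ∀ c (f : X → ℕ) xs → ∑ xs (λ x → c * f x) ≡ c * ∑ xs f
  ∑-*ˡ c f []       = sym (*-zeroʳ c)
  ∑-*ˡ c f (x ∷ xs) = trans (cong (λ t → c * f x + t) (∑-*ˡ c f xs)) (sym (*-distribˡ-+ c (f x) (∑ xs f)))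

  ∑-++ : ∀ (f : X → ℕ) xs ys → ∑ (xs ++ ys) f ≡ ∑ xs f + ∑ ys f
  ∑-++ f xs ys = trans (cong sum (map-++ f xs ys)) (sum-++ (map f xs) (map f ys))

  length-filterᵇ : ∀ (p : X → Bool) xs → length (filterᵇ p xs) ≡ ∑ xs (𝟙 ∘ p)
  length-filterᵇ p []       = refl
  length-filterᵇ p (x ∷ xs) with p x
  ... | true  = cong ℕ.suc (length-filterᵇ p xs)
  ... | false = length-filterᵇ p xs

  ∑-filterᵇ : ∀ (p : X → Bool) (f : X → ℕ) xs → ∑ (filterᵇ p xs) f ≡ ∑ xs (λ x → 𝟙 (p x) * f x)
  ∑-filterᵇ p f []       = refl
  ∑-filterᵇ p f (x ∷ xs) with p x
  ... | true  = cong₂ _+_ (sym (*-identityˡ (f x))) (∑-filterᵇ p f xs)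
  ... | false = ∑-filterᵇ p f xs

  ∑-filterᵇ-split : ∀ (p : X → Bool) (f : X → ℕ) xs →
                    ∑ xs f ≡ ∑ (filterᵇ p xs) f + ∑ (filterᵇ (not ∘ p) xs) f
  ∑-filterᵇ-split p f []       = refl
  ∑-filterᵇ-split p f (x ∷ xs) with p x
  ... | true  = trans (cong (λ t → f x + t) (∑-filterᵇ-split p f xs)) (sym (+-assoc (f x) _ _))
  ... | false = trans (cong (λ t → f x + t) (∑-filterᵇ-split p f xs)) (+-x∙yz≈y∙xz (f x) (∑ (filterᵇ p xs) f) _)

  module _ (_≟_ : DecidableEquality X) where

    ∑-select-absent : ∀ {c} (f : X → ℕ) {xs} → All (c ≢_) xs →
                      ∑ xs (λ y → 𝟙 (does (y ≟ c)) * f y) ≡ 0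
    ∑-select-absent f []                  = refl
    ∑-select-absent {c} f {x ∷ _} (c≢x ∷ c∉xs) with x ≟ c
    ... | yes refl = contradiction refl c≢x
    ... | no _     = ∑-select-absent f c∉xs

    ∑-select : ∀ {c} (f : X → ℕ) {xs} → Unique xs → c ∈ xs →
               ∑ xs (λ y → 𝟙 (does (y ≟ c)) * f y) ≡ f c
    ∑-select {c} f {x ∷ xs} (x∉xs ∷ _) _ with x ≟ c
    ... | yes refl = trans (cong₂ _+_ (*-identityˡ (f x)) (∑-select-absent f x∉xs)) (+-identityʳ (f x))
    ∑-select f (_ ∷ _)      (here refl) | no x≢c = contradiction refl x≢c
    ∑-select f (_ ∷ unique) (there c∈xs) | no _ = ∑-select f unique c∈xs

module _ {a b} {X : Set a} {Y : Set b} where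

  ∑-cartesianProduct : ∀ (h : X × Y → ℕ) xs ys →
                       ∑ (cartesianProduct xs ys) h ≡ ∑ xs (λ x → ∑ ys (λ y → h (x , y)))
  ∑-cartesianProduct h []       ys = refl
  ∑-cartesianProduct h (x ∷ xs) ys = begin
    ∑ (map (x ,_) ys ++ cartesianProduct xs ys) h
      ≡⟨ ∑-++ h (map (x ,_) ys) _ ⟩
    ∑ (map (x ,_) ys) h + ∑ (cartesianProduct xs ys) h
      ≡⟨ cong₂ _+_ (cong sum (sym (map-∘ ys))) (∑-cartesianProduct h xs ys) ⟩
    ∑ ys (λ y → h (x , y)) + ∑ xs (λ x → ∑ ys (λ y → h (x , y)))
      ∎
    where open ≡-Reasoning

  ∑-comm : ∀ (f : X → Y → ℕ) xs ys →
           ∑ xs (λ x → ∑ ys (f x)) ≡ ∑ ys (λ y → ∑ xs (λ x → f x y))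
  ∑-comm f []       ys = sym (∑-zero ys)
  ∑-comm f (x ∷ xs) ys = trans (cong (λ t → ∑ ys (f x) + t) (∑-comm f xs ys))
                               (sym (∑-+ (f x) (λ y → ∑ xs (λ x → f x y)) ys))

m+n≡o⇔m≡o-n : ∀ m n o → m + n ≡ o ⇔ (+ m ≡ + o - + n)
m+n≡o⇔m≡o-n m n o = mk⇔
  (λ m+n≡o → x≈z//y (+ m) (+ n) (+ o) (trans (sym (pos-+ m n)) (cong +_ m+n≡o)))
  (λ m≡o-n → cong ℤ.∣_∣ (trans (pos-+ m n) (trans (cong (ℤ._+ + n) m≡o-n) (//-rightDividesˡ (+ n) (+ o)))))
  where open GroupProperties (AbelianGroup.group +-0-abelianGroup) using (x≈z//y; //-rightDividesˡ)

module DifferenceCounting (G : FiniteAbelianGroup) where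
  open FiniteAbelianGroup G
    using (_≟_; 0#; -_; isAbelianGroup; elems; elems-unique; elems-complete;
           Disjoint; pairs; multD₂; multD; multExt)
    renaming (_+_ to _⊕_; _-_ to _⊖_; ∣_∣ to card)

  private
    abelianGroup : AbelianGroup _ _
    abelianGroup = record { isAbelianGroup = isAbelianGroup }

  open AbelianGroup abelianGroup using (assoc; identityʳ)
  open AbelianGroupProperties abelianGroup using (⁻¹-anti-homo‿-; xyx⁻¹≈y; ε⁻¹≈ε; x∙y⁻¹≈ε⇒x≈y; x≈y⇒x∙y⁻¹≈ε)

  x⊖[x⊖y]≡y : ∀ x y → x ⊖ (x ⊖ y) ≡ y
  x⊖[x⊖y]≡y x y = trans (cong (x ⊕_) (⁻¹-anti-homo‿- x y)) (trans (sym (assoc x y (- x))) (xyx⁻¹≈y x y))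

  x⊖0≡x : ∀ x → x ⊖ 0# ≡ x
  x⊖0≡x x = trans (cong (x ⊕_) ε⁻¹≈ε) (identityʳ x)

  x⊖y≡g⇔y≡x⊖g : ∀ {x y g} → x ⊖ y ≡ g ⇔ y ≡ x ⊖ g
  x⊖y≡g⇔y≡x⊖g {x} {y} {g} = mk⇔
    (λ x⊖y≡g → trans (sym (x⊖[x⊖y]≡y x y)) (cong (x ⊖_) x⊖y≡g))
    (λ y≡x⊖g → trans (cong (x ⊖_) y≡x⊖g) (x⊖[x⊖y]≡y x g))

  x⊖y≡0⇔x≡y : ∀ {x y} → x ⊖ y ≡ 0# ⇔ x ≡ y
  x⊖y≡0⇔x≡y {x} {y} = mk⇔ (x∙y⁻¹≈ε⇒x≈y x y) x≈y⇒x∙y⁻¹≈ε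

  multD₂≡∑ : ∀ (A B : Subset G) g → multD₂ A B g ≡ ∑ elems (λ x → 𝟙 (A x ∧ B (x ⊖ g)))
  multD₂≡∑ A B g = begin
    multD₂ A B g
      ≡⟨ length-filterᵇ _ pairs ⟩
    ∑ pairs _
      ≡⟨ ∑-cartesianProduct _ elems elems ⟩
    ∑ elems (λ x → ∑ elems (λ y → 𝟙 (A x ∧ B y ∧ does ((x ⊖ y) ≟ g))))
      ≡⟨ ∑-cong (λ x → ∑-cong (pair x) elems) elems ⟩
    ∑ elems (λ x → ∑ elems (λ y → 𝟙 (does (y ≟ (x ⊖ g))) * 𝟙 (A x ∧ B y)))
      ≡⟨ ∑-cong (λ x → ∑-select _≟_ (λ y → 𝟙 (A x ∧ B y)) elems-unique (elems-complete (x ⊖ g))) elems ⟩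
    ∑ elems (λ x → 𝟙 (A x ∧ B (x ⊖ g)))
      ∎
    where
    open ≡-Reasoning
    pair : ∀ x y → 𝟙 (A x ∧ B y ∧ does ((x ⊖ y) ≟ g)) ≡ 𝟙 (does (y ≟ (x ⊖ g))) * 𝟙 (A x ∧ B y)
    pair x y = trans (𝟙-∧-∧ (A x) (B y) _)
      (cong (λ b → 𝟙 b * 𝟙 (A x ∧ B y)) (does-⇔ x⊖y≡g⇔y≡x⊖g ((x ⊖ y) ≟ g) (y ≟ (x ⊖ g))))

  multD₂-self-zero : ∀ (A : Subset G) → multD₂ A A 0# ≡ card A
  multD₂-self-zero A = trans (multD₂≡∑ A A 0#) (trans (∑-cong diagonal elems) (sym (length-filterᵇ A elems)))
    where
    diagonal : ∀ x → 𝟙 (A x ∧ A (x ⊖ 0#)) ≡ 𝟙 (A x)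
    diagonal x = trans (cong (λ y → 𝟙 (A x ∧ A y)) (x⊖0≡x x)) (cong 𝟙 (∧-idem (A x)))

  multD-zero : ∀ (A : Subset G) → multD A 0# ≡ 0
  multD-zero A = begin
    multD A 0#         ≡⟨ length-filterᵇ _ pairs ⟩
    ∑ pairs _          ≡⟨ ∑-cong (λ { (x , y) → cong 𝟙 (vanishes x y) }) pairs ⟩
    ∑ pairs (λ _ → 0)  ≡⟨ ∑-zero pairs ⟩
    0                  ∎
    where
    open ≡-Reasoning
    vanishes : ∀ x y → A x ∧ A y ∧ not (does (x ≟ y)) ∧ does ((x ⊖ y) ≟ 0#) ≡ false
    vanishes x y = begin
      A x ∧ A y ∧ not (does (x ≟ y)) ∧ does ((x ⊖ y) ≟ 0#)
        ≡⟨ cong (λ b → A x ∧ A y ∧ not (does (x ≟ y)) ∧ b) (does-⇔ x⊖y≡0⇔x≡y ((x ⊖ y) ≟ 0#) (x ≟ y)) ⟩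
      A x ∧ A y ∧ not (does (x ≟ y)) ∧ does (x ≟ y)
        ≡⟨ cong (λ b → A x ∧ A y ∧ b) (∧-inverseˡ (does (x ≟ y))) ⟩
      A x ∧ A y ∧ false
        ≡⟨ cong (A x ∧_) (∧-zeroʳ (A y)) ⟩
      A x ∧ false
        ≡⟨ ∧-zeroʳ (A x) ⟩
      false
        ∎

  multD≡multD₂ : ∀ (A : Subset G) {g} → g ≢ 0# → multD A g ≡ multD₂ A A g
  multD≡multD₂ A {g} g≢0 = begin
    multD A g       ≡⟨ length-filterᵇ _ pairs ⟩
    ∑ pairs _       ≡⟨ ∑-cong (λ { (x , y) → cong (λ b → 𝟙 (A x ∧ A y ∧ b)) (distinct x y) }) pairs ⟨
    ∑ pairs _       ≡⟨ length-filterᵇ _ pairs ⟨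
    multD₂ A A g    ∎
    where
    open ≡-Reasoning
    distinct : ∀ x y → does ((x ⊖ y) ≟ g) ≡ not (does (x ≟ y)) ∧ does ((x ⊖ y) ≟ g)
    distinct x y with (x ⊖ y) ≟ g
    ... | no _        = sym (∧-zeroʳ _)
    ... | yes x⊖y≡g with x ≟ y
    ...   | yes x≡y = contradiction (trans (sym x⊖y≡g) (Equivalence.from x⊖y≡0⇔x≡y x≡y)) g≢0
    ...   | no _    = refl

  module Partition {m} {A : Fin m → Subset G} (partition : IsPartition G m A) where

    disjoint : ∀ i j → i ≢ j → Disjoint (A i) (A j)
    disjoint i j i≢j x (x∈Aᵢ , x∈Aⱼ) with proj₁ partition x
    ... | _ , _ , unique = i≢j (trans (unique i x∈Aᵢ) (sym (unique j x∈Aⱼ)))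

    ∑-blocks : ∀ z → ∑ (allFin m) (λ j → 𝟙 (A j z)) ≡ 1
    ∑-blocks z with proj₁ partition z
    ... | o , z∈Aₒ , unique =
      trans (∑-cong (λ j → trans (cong 𝟙 (A-owner j)) (sym (*-identityʳ _))) (allFin m))
            (∑-select _≟ᶠ_ (λ _ → 1) (allFin⁺ m) (∈-allFin o))
      where
      A-owner : ∀ j → A j z ≡ does (j ≟ᶠ o)
      A-owner j with j ≟ᶠ o
      ... | yes refl = z∈Aₒ
      ... | no j≢o   = ¬-not (j≢o ∘ unique j)

    ∑-multD₂-blocks : ∀ i g → ∑ (allFin m) (λ j → multD₂ (A i) (A j) g) ≡ card (A i)
    ∑-multD₂-blocks i g = begin
      ∑ (allFin m) (λ j → multD₂ (A i) (A j) g)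
        ≡⟨ ∑-cong (λ j → multD₂≡∑ (A i) (A j) g) (allFin m) ⟩
      ∑ (allFin m) (λ j → ∑ elems (λ x → 𝟙 (A i x ∧ A j (x ⊖ g))))
        ≡⟨ ∑-comm (λ j x → 𝟙 (A i x ∧ A j (x ⊖ g))) (allFin m) elems ⟩
      ∑ elems (λ x → ∑ (allFin m) (λ j → 𝟙 (A i x ∧ A j (x ⊖ g))))
        ≡⟨ ∑-cong (λ x → trans (∑-cong (λ j → 𝟙-∧ (A i x) (A j (x ⊖ g))) (allFin m))
                               (∑-*ˡ (𝟙 (A i x)) (λ j → 𝟙 (A j (x ⊖ g))) (allFin m))) elems ⟩
      ∑ elems (λ x → 𝟙 (A i x) * ∑ (allFin m) (λ j → 𝟙 (A j (x ⊖ g))))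
        ≡⟨ ∑-cong (λ x → trans (cong (𝟙 (A i x) *_) (∑-blocks (x ⊖ g))) (*-identityʳ _)) elems ⟩
      ∑ elems (λ x → 𝟙 (A i x))
        ≡⟨ length-filterᵇ (A i) elems ⟨
      card (A i)
        ∎
      where open ≡-Reasoning

    multD₂-self+multExt : ∀ i g → multD₂ (A i) (A i) g + multExt A i g ≡ card (A i)
    multD₂-self+multExt i g = begin
      multD₂ (A i) (A i) g + multExt A i g
        ≡⟨ cong (λ t → t + multExt A i g) (∑-select _≟ᶠ_ D (allFin⁺ m) (∈-allFin i)) ⟨
      ∑ (allFin m) (λ j → 𝟙 (does (j ≟ᶠ i)) * D j) + multExt A i g
        ≡⟨ cong (λ t → t + multExt A i g) (∑-filterᵇ (λ j → does (j ≟ᶠ i)) D (allFin m)) ⟨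
      ∑ (filterᵇ (λ j → does (j ≟ᶠ i)) (allFin m)) D + multExt A i g
        ≡⟨ ∑-filterᵇ-split (λ j → does (j ≟ᶠ i)) D (allFin m) ⟨
      ∑ (allFin m) D
        ≡⟨ ∑-multD₂-blocks i g ⟩
      card (A i)
        ∎
      where
      open ≡-Reasoning
      D : Fin m → ℕ
      D j = multD₂ (A i) (A j) g

    multExt-zero : ∀ i → multExt A i 0# ≡ 0
    multExt-zero i = +-cancelˡ-≡ (card (A i)) _ _ (begin
      card (A i) + multExt A i 0#           ≡⟨ cong (λ t → t + multExt A i 0#) (multD₂-self-zero (A i)) ⟨
      multD₂ (A i) (A i) 0# + multExt A i 0# ≡⟨ multD₂-self+multExt i 0# ⟩
      card (A i)                            ≡⟨ +-identityʳ (card (A i)) ⟨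
      card (A i) + 0                        ∎)
      where open ≡-Reasoning

    multD+multExt : ∀ i {g} → g ≢ 0# → multD (A i) g + multExt A i g ≡ card (A i)
    multD+multExt i {g} g≢0 =
      trans (cong (λ t → t + multExt A i g) (multD≡multD₂ (A i) g≢0)) (multD₂-self+multExt i g)

mainTheorem3 : (G : FiniteAbelianGroup) (n m : ℕ) (A : Fin m → Subset G)
    (k lam : Fin m → ℕ) →
    order G ≡ n →
    IsPartition G m A →
    (∀ i → ∣_∣ G (A i) ≡ k i) →
    (IsGSEDF G m A k lam → (∀ i → IsDifferenceSet G (A i) (k i) (+ k i - + lam i)))
    × ((∀ i → IsDifferenceSet G (A i) (k i) (+ k i - + lam i)) → IsGSEDF G m A k lam)
mainTheorem3 G n m A k lam _ partition ∣Aᵢ∣≡kᵢ = gsedf⇒differenceSets , differenceSets⇒gsedf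
  where
  open FiniteAbelianGroup G using (0#; multD; multExt)
  open DifferenceCounting G using (multD-zero)
  open DifferenceCounting.Partition G partition using (disjoint; multExt-zero; multD+multExt)

  multD+multExt≡k : ∀ i {g} → g ≢ 0# → multD (A i) g + multExt A i g ≡ k i
  multD+multExt≡k i g≢0 = trans (multD+multExt i g≢0) (∣Aᵢ∣≡kᵢ i)

  gsedf⇒differenceSets : IsGSEDF G m A k lam → ∀ i → IsDifferenceSet G (A i) (k i) (+ k i - + lam i)
  gsedf⇒differenceSets (_ , _ , _ , multExt≡lam) i = ∣Aᵢ∣≡kᵢ i , multD-zero (A i) , λ g g≢0 →
    Equivalence.to (m+n≡o⇔m≡o-n _ (lam i) (k i))
      (trans (cong (λ t → multD (A i) g + t) (sym (multExt≡lam i g g≢0))) (multD+multExt≡k i g≢0))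

  differenceSets⇒gsedf : (∀ i → IsDifferenceSet G (A i) (k i) (+ k i - + lam i)) → IsGSEDF G m A k lam
  differenceSets⇒gsedf differenceSet = disjoint , ∣Aᵢ∣≡kᵢ , multExt-zero , λ i g g≢0 →
    +-cancelˡ-≡ (multD (A i) g) _ _
      (trans (multD+multExt≡k i g≢0)
             (sym (Equivalence.from (m+n≡o⇔m≡o-n _ (lam i) (k i)) (proj₂ (proj₂ (differenceSet i)) g g≢0))))
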